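{- In the generic bisimulation game (for any $E\subseteq\{\ominus,\oplus\}$) on a labelled transition system, for all $s,t,c,m$ the configurations $[(s,t),c,m,*]_{\mathrm{Sp}}$ and $[(s,t),c,m,\checkmark]_{\mathrm{Sp}}$ are won by the same player, and likewise the configurations $[(s,t),c,m,*]_{\mathrm{Du}}$ and $[(s,t),c,m,\checkmark]_{\mathrm{Du}}$ are won by the same player.
   Context: LTS $L=(S,A,\to)$: states $S$, actions $A$ containing the internal action $\tau$, transitions written $s\xrightarrow{a}t$. Generic bisimulation game: let $\ominus,\oplus$ be distinct symbols and $E\subseteq\{\ominus,\oplus\}$. Players Spoiler and Duplicator; configurations $[(s,t),c,m,r]_{\mathrm{Sp}}$ (Spoiler-owned) and $[(s,t),c,m,r]_{\mathrm{Du}}$ (Duplicator-owned) with $(s,t)\in S\times S$, $c\in(A\times S)\cup\{\dagger\}$, $m\in(S\times\{\ominus,\oplus\})\cup\{\dagger\}$, $r\in\{*,\checkmark\}$. Spoiler from $[(s,t),c,m,r]_{\mathrm{Sp}}$: (S1) if $c\neq\dagger$, to $[(s,t),c,m,*]_{\mathrm{Du}}$; (S2a) for $s\xrightarrow{a}s'$, if $c=\dagger$, to $[(s,t),(a,s'),(t,\ominus),*]_{\mathrm{Du}}$; (S2b) for $s\xrightarrow{a}s'$, if $c\neq(a,s')$, to $[(s,t),(a,s'),(t,\ominus),\checkmark]_{\mathrm{Du}}$; (S3) for $t\xrightarrow{a}t'$, to $[(t,s),(a,t'),(s,\ominus),\checkmark]_{\mathrm{Du}}$. Duplicator from $[(u,v),(a,u'),(\bar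 v,f),r]_{\mathrm{Du}}$: (D1) if $a=\tau$, to $[(u',\bar v),\dagger,\dagger,\checkmark]_{\mathrm{Sp}}$; (D2) if $f=\ominus$ and $\bar v\xrightarrow{a}v'$, to (a) $[(u',v'),(a,u'),(v',\oplus),*]_{\mathrm{Sp}}$, (b) $[(u',v'),\dagger,\dagger,\checkmark]_{\mathrm{Sp}}$, or (c) only if $\oplus\in E$, $[(u,v),(a,u'),(v',\oplus),*]_{\mathrm{Sp}}$; (D3) for $\bar v\xrightarrow{\tau}v'$, to (a) $[(u,v'),(a,u'),(v',f),*]_{\mathrm{Sp}}$, (b) only if $f=\oplus$, $[(u',v'),\dagger,\dagger,\checkmark]_{\mathrm{Sp}}$, or (c) only if $f\in E$, $[(u,v),(a,u'),(v',f),*]_{\mathrm{Sp}}$. No other Duplicator moves. Duplicator wins a finite play iff it ends because Spoiler cannot move, and an infinite play iff it has infinitely many $\checkmark$ rewards; otherwise Spoiler wins. A player wins a configuration if she has a strategy winning all plays starting in it. -}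

module Defs where

open import Data.Bool using (Bool; T)
open import Data.Maybe using (Maybe; just; nothing)
open import Data.Product using (Σ; ∃; _×_; _,_)
open import Data.Sum using (_⊎_)
open import Data.Nat using (ℕ; zero; suc; _≤_; _<_)
open import Data.List using (List; map; upTo)
open import Relation.Binary.PropositionalEquality using (_≡_; _≢_)
open import Relation.Nullary using (¬_)
open import Data.Unit using (⊤)

record LTS : Set₁ where
  field
    State  : Set
    Action : Set
    τ      : Action
    _⟶[_]_ : State → Action → State → Set

data Player : Set where
  Sp Du : Player

data Sign : Set where
  ⊖ ⊕ : Sign

data Rew : Set where
  ⋆ ✓ : Rew

-- E ⊆ {⊖, ⊕} is represented by its characteristic function; f ∈ E is T (E f).
SignSet : Set
SignSet = Sign → Bool

module Game (L : LTS) (E : SignSet) where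
  open LTS L

  -- the component c ∈ (A × S) ∪ {†}   (nothing = †)
  CompC : Set
  CompC = Maybe (Action × State)

  -- the component m ∈ (S × {⊖,⊕}) ∪ {†}   (nothing = †)
  CompM : Set
  CompM = Maybe (State × Sign)

  data Conf : Set where
    ⟦_∥_∥_∥_⟧_ : State × State → CompC → CompM → Rew → Player → Conf

  cfg : Player → State → State → CompC → CompM → Rew → Conf
  cfg P s t c m r = ⟦ (s , t) ∥ c ∥ m ∥ r ⟧ P

  owner : Conf → Player
  owner (⟦ _ ∥ _ ∥ _ ∥ _ ⟧ P) = P

  reward : Conf → Rew
  reward (⟦ _ ∥ _ ∥ _ ∥ r ⟧ _) = r

  data Move : Conf → Conf → Set where
    S1  : ∀ {s t c m r} → c ≢ nothing →
          Move (cfg Sp s t c m r) (cfg Du s t c m ⋆)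
    S2a : ∀ {s t m r a s'} → s ⟶[ a ] s' →
          Move (cfg Sp s t nothing m r) (cfg Du s t (just (a , s')) (just (t , ⊖)) ⋆)
    S2b : ∀ {s t c m r a s'} → s ⟶[ a ] s' → c ≢ just (a , s') →
          Move (cfg Sp s t c m r) (cfg Du s t (just (a , s')) (just (t , ⊖)) ✓)
    S3  : ∀ {s t c m r a t'} → t ⟶[ a ] t' →
          Move (cfg Sp s t c m r) (cfg Du t s (just (a , t')) (just (s , ⊖)) ✓)
    D1  : ∀ {u v a u' v̄ f r} → a ≡ τ →
          Move (cfg Du u v (just (a , u')) (just (v̄ , f)) r) (cfg Sp u' v̄ nothing nothing ✓)
    D2a : ∀ {u v a u' v̄ r v'} → v̄ ⟶[ a ] v' →
          Move (cfg Du u v (just (a , u')) (just (v̄ , ⊖)) r)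
               (cfg Sp u' v' (just (a , u')) (just (v' , ⊕)) ⋆)
    D2b : ∀ {u v a u' v̄ r v'} → v̄ ⟶[ a ] v' →
          Move (cfg Du u v (just (a , u')) (just (v̄ , ⊖)) r) (cfg Sp u' v' nothing nothing ✓)
    D2c : ∀ {u v a u' v̄ r v'} → T (E ⊕) → v̄ ⟶[ a ] v' →
          Move (cfg Du u v (just (a , u')) (just (v̄ , ⊖)) r)
               (cfg Sp u v (just (a , u')) (just (v' , ⊕)) ⋆)
    D3a : ∀ {u v a u' v̄ f r v'} → v̄ ⟶[ τ ] v' →
          Move (cfg Du u v (just (a , u')) (just (v̄ , f)) r)
               (cfg Sp u v' (just (a , u')) (just (v' , f)) ⋆)
    D3b : ∀ {u v a u' v̄ r v'} → v̄ ⟶[ τ ] v' →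
          Move (cfg Du u v (just (a , u')) (just (v̄ , ⊕)) r) (cfg Sp u' v' nothing nothing ✓)
    D3c : ∀ {u v a u' v̄ f r v'} → T (E f) → v̄ ⟶[ τ ] v' →
          Move (cfg Du u v (just (a , u')) (just (v̄ , f)) r)
               (cfg Sp u v (just (a , u')) (just (v' , f)) ⋆)

  Stuck : Conf → Set
  Stuck x = ∀ y → ¬ Move x y

  record Strategy (P : Player) : Set where
    field
      choose : List Conf → Conf → Conf
      legal  : ∀ h x → owner x ≡ P → ∀ y → Move x y → Move x (choose h x)
  open Strategy public

  hist : (ℕ → Conf) → ℕ → List Conf
  hist f i = map f (upTo i)

  data Shape (f : ℕ → Conf) : Set where
    finite   : (n : ℕ) → (∀ i → i < n → Move (f i) (f (suc i))) → Stuck (f n) → Shape f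
    infinite : (∀ i → Move (f i) (f (suc i))) → Shape f

  Continues : ∀ {f} → Shape f → ℕ → Set
  Continues (finite n _ _) i = i < n
  Continues (infinite _)   i = ⊤

  record Play (x : Conf) : Set where
    field
      seq   : ℕ → Conf
      start : seq zero ≡ x
      shape : Shape seq
  open Play public

  ConsistentWith : ∀ {P x} → Strategy P → Play x → Set
  ConsistentWith {P} σ π =
    ∀ i → Continues (shape π) i → owner (seq π i) ≡ P →
      seq π (suc i) ≡ choose σ (hist (seq π) i) (seq π i)

  -- winning condition for Duplicator on a maximal play: a finite play is won by
  -- Duplicator iff it ends because Spoiler cannot move (last configuration owned by
  -- Spoiler); an infinite play iff infinitely many configurations carry reward ✓.
  DuWinsShape : ∀ {f} → Shape f → Set
  DuWinsShape {f} (finite n _ _) = owner (f n) ≡ Sp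
  DuWinsShape {f} (infinite _)   = ∀ n → ∃ λ k → n ≤ k × reward (f k) ≡ ✓

  WinsPlay : Player → ∀ {x} → Play x → Set
  WinsPlay Du π = DuWinsShape (shape π)
  WinsPlay Sp π = ¬ DuWinsShape (shape π)

  Wins : Player → Conf → Set
  Wins P x = Σ (Strategy P) λ σ → (π : Play x) → ConsistentWith σ π → WinsPlay P π

-- So changing the reward of the start configuration changes neither the legal
-- plays nor who wins them, and a strategy from one start configuration works for the other.
module Submission where

open import Defs
open import Data.Product using (_×_; _,_; ∃)
open import Function using (id)
open import Function.Bundles using (_⇔_; mk⇔; Equivalence)
open import Data.List using (List; []; _∷_)
open import Data.List.Properties using (map-applyUpTo)
open import Data.Nat using (ℕ; zero; suc; _≤_; _<_)
open import Data.Nat.Properties using (≤-trans; n≤1+n)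
open import Data.Unit using (tt)
open import Relation.Binary.PropositionalEquality using (_≡_; refl; sym; trans; cong)

module _ (L : LTS) (E : SignSet) where
  open Game L E

  withReward : Rew → Conf → Conf
  withReward r (⟦ p ∥ c ∥ m ∥ _ ⟧ P) = ⟦ p ∥ c ∥ m ∥ r ⟧ P

  owner-withReward : ∀ r x → owner (withReward r x) ≡ owner x
  owner-withReward r (⟦ _ ∥ _ ∥ _ ∥ _ ⟧ _) = refl

  move-withReward : ∀ r {x y} → Move x y → Move (withReward r x) y
  move-withReward r (S1 c≢†)     = S1 c≢†
  move-withReward r (S2a s⟶)     = S2a s⟶
  move-withReward r (S2b s⟶ c≢)  = S2b s⟶ c≢
  move-withReward r (S3 t⟶)      = S3 t⟶
  move-withReward r (D1 a≡τ)     = D1 a≡τ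
  move-withReward r (D2a v⟶)     = D2a v⟶
  move-withReward r (D2b v⟶)     = D2b v⟶
  move-withReward r (D2c ⊕∈E v⟶) = D2c ⊕∈E v⟶
  move-withReward r (D3a v⟶)     = D3a v⟶
  move-withReward r (D3b v⟶)     = D3b v⟶
  move-withReward r (D3c f∈E v⟶) = D3c f∈E v⟶

  move-withReward⁻ : ∀ r x {y} → Move (withReward r x) y → Move x y
  move-withReward⁻ r (⟦ _ ∥ _ ∥ _ ∥ r₀ ⟧ _) = move-withReward r₀

  stuck-withReward : ∀ r x → Stuck x → Stuck (withReward r x)
  stuck-withReward r x stuck y mv = stuck y (move-withReward⁻ r x mv)

  InfinitelyManyChecks : (ℕ → Conf) → Set
  InfinitelyManyChecks f = ∀ n → ∃ λ k → n ≤ k × reward (f k) ≡ ✓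

  infinitelyManyChecks-tail : ∀ {f g} → (∀ i → reward (f (suc i)) ≡ reward (g (suc i))) →
                              InfinitelyManyChecks f → InfinitelyManyChecks g
  infinitelyManyChecks-tail f≗g checks n with checks (suc n)
  ... | suc k , 1+n≤1+k , fk≡✓ = suc k , ≤-trans (n≤1+n n) 1+n≤1+k , trans (sym (f≗g k)) fk≡✓

  withInitialReward : Rew → (ℕ → Conf) → ℕ → Conf
  withInitialReward r f zero    = withReward r (f zero)
  withInitialReward r f (suc i) = f (suc i)

  withInitialRewardˡ : Rew → List Conf → List Conf
  withInitialRewardˡ r []       = []
  withInitialRewardˡ r (x ∷ xs) = withReward r x ∷ xs

  owner-withInitialReward : ∀ r f i → owner (withInitialReward r f i) ≡ owner (f i)
  owner-withInitialReward r f zero    = owner-withReward r (f zero)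
  owner-withInitialReward r f (suc i) = refl

  hist-withInitialReward : ∀ r f j →
    hist (withInitialReward r f) (suc j) ≡ withInitialRewardˡ r (hist f (suc j))
  hist-withInitialReward r f j = cong (withReward r (f zero) ∷_)
    (trans (map-applyUpTo suc (withInitialReward r f) j) (sym (map-applyUpTo suc f j)))

  shape-withInitialReward : ∀ r {f} → Shape f → Shape (withInitialReward r f)
  shape-withInitialReward r {f} (finite n moves stuck) = finite n moves′ (stuck′ n stuck)
    where
      moves′ : ∀ i → i < n → Move (withInitialReward r f i) (withInitialReward r f (suc i))
      moves′ zero    i<n = move-withReward r (moves zero i<n)
      moves′ (suc i) i<n = moves (suc i) i<n
      stuck′ : ∀ k → Stuck (f k) → Stuck (withInitialReward r f k)
      stuck′ zero    = stuck-withReward r (f zero)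
      stuck′ (suc k) = id
  shape-withInitialReward r {f} (infinite moves) = infinite moves′
    where
      moves′ : ∀ i → Move (withInitialReward r f i) (withInitialReward r f (suc i))
      moves′ zero    = move-withReward r (moves zero)
      moves′ (suc i) = moves (suc i)

  continues-withInitialReward : ∀ r {f} (sh : Shape f) i →
                                Continues (shape-withInitialReward r sh) i → Continues sh i
  continues-withInitialReward r (finite _ _ _) i i<n = i<n
  continues-withInitialReward r (infinite _)   i tt  = tt

  duWinsShape-withInitialReward : ∀ r {f} (sh : Shape f) →
                                  DuWinsShape sh ⇔ DuWinsShape (shape-withInitialReward r sh)
  duWinsShape-withInitialReward r {f} (finite n _ _) =
    mk⇔ (trans (owner-withInitialReward r f n)) (trans (sym (owner-withInitialReward r f n)))
  duWinsShape-withInitialReward r {f} (infinite _) =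
    mk⇔ (infinitelyManyChecks-tail {f} {withInitialReward r f} λ _ → refl)
        (infinitelyManyChecks-tail {withInitialReward r f} {f} λ _ → refl)

  play-withInitialReward : ∀ r {x} → Play x → Play (withReward r x)
  play-withInitialReward r π = record
    { seq   = withInitialReward r (seq π)
    ; start = cong (withReward r) (start π)
    ; shape = shape-withInitialReward r (shape π)
    }

  winsPlay-withInitialReward⁻ : ∀ P r {x} (π : Play x) →
                                WinsPlay P (play-withInitialReward r π) → WinsPlay P π
  winsPlay-withInitialReward⁻ Du r π = Equivalence.from (duWinsShape-withInitialReward r (shape π))
  winsPlay-withInitialReward⁻ Sp r π ¬duWins duWins =
    ¬duWins (Equivalence.to (duWinsShape-withInitialReward r (shape π)) duWins)

  -- σ played on the play whose start configuration x₀ carries reward r instead; x₀ is the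
  -- current configuration while the history is empty and the head of the history afterwards.
  assumingInitialReward : ∀ {P} → Rew → Strategy P → Strategy P
  assumingInitialReward r σ .choose []      x = choose σ [] (withReward r x)
  assumingInitialReward r σ .choose (x₀ ∷ h) x = choose σ (withInitialRewardˡ r (x₀ ∷ h)) x
  assumingInitialReward r σ .legal  []      x ownsx y mv =
    move-withReward⁻ r x
      (legal σ [] (withReward r x) (trans (owner-withReward r x) ownsx) y (move-withReward r mv))
  assumingInitialReward r σ .legal  (x₀ ∷ h) x ownsx y mv =
    legal σ (withInitialRewardˡ r (x₀ ∷ h)) x ownsx y mv

  consistent-withInitialReward : ∀ {P} r (σ : Strategy P) {x} (π : Play x) →
    ConsistentWith (assumingInitialReward r σ) π → ConsistentWith σ (play-withInitialReward r π)
  consistent-withInitialReward r σ π consistent zero continues owns =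
    consistent zero (continues-withInitialReward r (shape π) zero continues)
                    (trans (sym (owner-withInitialReward r (seq π) zero)) owns)
  consistent-withInitialReward r σ π consistent (suc j) continues owns =
    trans (consistent (suc j) (continues-withInitialReward r (shape π) (suc j) continues) owns)
          (cong (λ h → choose σ h (seq π (suc j))) (sym (hist-withInitialReward r (seq π) j)))

  wins-withReward⁻ : ∀ P r x → Wins P (withReward r x) → Wins P x
  wins-withReward⁻ P r x (σ , σ-wins) = assumingInitialReward r σ , λ π consistent →
    winsPlay-withInitialReward⁻ P r π
      (σ-wins (play-withInitialReward r π) (consistent-withInitialReward r σ π consistent))

proposition5p7 : (L : LTS) (E : SignSet) →
    let open Game L E in
    ∀ (s t : LTS.State L) (c : CompC) (m : CompM) →
    ((P : Player) → Wins P (⟦ (s , t) ∥ c ∥ m ∥ ⋆ ⟧ Sp) ⇔ Wins P (⟦ (s , t) ∥ c ∥ m ∥ ✓ ⟧ Sp))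
    × ((P : Player) → Wins P (⟦ (s , t) ∥ c ∥ m ∥ ⋆ ⟧ Du) ⇔ Wins P (⟦ (s , t) ∥ c ∥ m ∥ ✓ ⟧ Du))
proposition5p7 L E s t c m =
  (λ P → mk⇔ (wins-withReward⁻ L E P ⋆ _) (wins-withReward⁻ L E P ✓ _)) ,
  (λ P → mk⇔ (wins-withReward⁻ L E P ⋆ _) (wins-withReward⁻ L E P ✓ _))
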